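{- Let $(E,w,d)$ be an ultra triple, let $C=(c_1,\dots,c_k)$ be an ordered list of distinct points of $E$, and let $A\subseteq E$ be a finite set with $|A|=n\ge k$. Let $(v_1,\dots,v_k)$ be any choice of $\operatorname{proj}(C\to A)$. Then for each $j\in\{1,\dots,k\}$, \[ (A\setminus\{v_1,\dots,v_j\})\cap\{c_1,\dots,c_j\}=\varnothing . \]
   Context: An ultra triple $(E,w,d)$ consists of a set $E$, an arbitrary function $w:E\to\mathbb{R}$, and a function $d$ defined on pairs of distinct points of $E$ with real values such that $d(a,b)=d(b,a)$ and $d(a,b)\le\max\{d(a,c),d(b,c)\}$ for all pairwise distinct $a,b,c\in E$ (distances may be negative). For a finite non-empty $A\subseteq E$ and $c\in E$, $\operatorname{proj}_A(c)$ is $\{c\}$ if $c\in A$, and otherwise the set of all $a\in A$ minimizing $d(c,a)$. For an ordered list $C=(c_1,\dots,c_k)$ of distinct points and a finite set $A$ with $|A|\ge k$, $\operatorname{proj}(C\to A)=(v_1,\dots,v_k)$ is defined recursively: $v_i$ is an (arbitrarily chosen) element of $\operatorname{proj}_{A\setminus\{v_1,\dots,v_{i-1}\}}(c_i)$, for $i=1,\dots,k$. -}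

module Defs where

open import Level using (Level; _⊔_; suc)
open import Data.Nat using (ℕ)
open import Data.Fin using (Fin; toℕ)
import Data.Nat as ℕ
open import Data.List using (List; length)
open import Data.List.Membership.Propositional using (_∈_)
open import Data.List.Relation.Unary.Unique.Propositional using (Unique)
open import Data.Product using (_×_; Σ-syntax)
open import Data.Sum using (_⊎_)
open import Relation.Nullary using (¬_)
open import Relation.Binary.PropositionalEquality using (_≡_; _≢_)
open import Relation.Binary.Bundles using (TotalOrder)

-- The real line is replaced by an arbitrary total order R.
-- An ultra triple (E, w, d) with values in R.  d is given as a total
-- function E → E → R, but only its values on pairs of distinct points
-- are constrained (and, below, only those are ever used).
record UltraTriple {c ℓ₁ ℓ₂ : Level} (R : TotalOrder c ℓ₁ ℓ₂) (e : Level)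
       : Set (Level.suc e ⊔ c ⊔ ℓ₁ ⊔ ℓ₂) where
  open TotalOrder R renaming (Carrier to ℝ)
  field
    E      : Set e
    w      : E → ℝ
    d      : E → E → ℝ
    d-sym  : ∀ a b → a ≢ b → d a b ≈ d b a
    -- d(a,b) ≤ max{d(a,c), d(b,c)}, written for a total order as a disjunction
    d-ultra : ∀ a b c → a ≢ b → a ≢ c → b ≢ c →
              (d a b ≤ d a c) ⊎ (d a b ≤ d b c)

module _ {c ℓ₁ ℓ₂ e : Level} {R : TotalOrder c ℓ₁ ℓ₂} (T : UltraTriple R e) where
  open TotalOrder R using (_≤_)
  open UltraTriple T

  -- A finite subset of E: a duplicate-free list.
  -- Membership in  A \ {v i | i < j}  (i, j indices in Fin k).
  InRemaining : ∀ {k} → List E → (Fin k → E) → ℕ → E → Set e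
  InRemaining A v j a = (a ∈ A) × (∀ i → toℕ i ℕ.< j → a ≢ v i)

  InProj : (E → Set e) → E → E → Set (e ⊔ ℓ₂)
  InProj B c x = (B c → x ≡ c)
               × (¬ B c → B x × (∀ a → B a → d c x ≤ d c a))

  -- (v 1, …, v k) is a valid choice of proj(C → A):
  -- v i ∈ proj_{A \ {v 1, …, v (i-1)}} (c i) for every i.
  IsProjChoice : ∀ {k} → (C : Fin k → E) → List E → (v : Fin k → E) → Set (e ⊔ ℓ₂)
  IsProjChoice {k} C A v = ∀ (i : Fin k) → InProj (InRemaining A v (toℕ i)) (C i) (v i)

module Submission where

open import Defs
open import Level using (Level)
open import Data.Nat using (ℕ; suc; _≤_; s≤s⁻¹)
open import Data.Nat.Properties using (<-≤-trans; m≤n⇒m≤1+n)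
open import Data.Fin using (Fin; toℕ)
open import Data.List using (List; length)
open import Data.List.Membership.Propositional using (_∈_)
open import Data.List.Relation.Unary.Unique.Propositional using (Unique)
open import Data.Product using (proj₁; _,_)
open import Function.Definitions using (Injective)
open import Relation.Binary.PropositionalEquality using (_≡_; _≢_; refl; sym)
open import Relation.Binary.Bundles using (TotalOrder)

-- If c_i ∈ A \ {v_1, …, v_j} with i ≤ j, then c_i is still available at step i,
-- so proj chooses v_i = c_i, contradicting c_i ∉ {v_1, …, v_j}.

module _ {c ℓ₁ ℓ₂ e : Level} {R : TotalOrder c ℓ₁ ℓ₂} (T : UltraTriple R e) where
  open UltraTriple T using (E)

  InRemaining-antitone : ∀ {k} {A : List E} {v : Fin k → E} {i j : ℕ} {a : E} →
                         i ≤ j → InRemaining T A v j a → InRemaining T A v i a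
  InRemaining-antitone i≤j (a∈A , a∉v) = a∈A , λ i′ i′<i → a∉v i′ (<-≤-trans i′<i i≤j)

  projChoice-fixes-remaining : ∀ {k} {C : Fin k → E} {A : List E} {v : Fin k → E} →
                               IsProjChoice T C A v →
                               ∀ i → InRemaining T A v (toℕ i) (C i) → v i ≡ C i
  projChoice-fixes-remaining choice i remaining = proj₁ (choice i) remaining

proposition2p8 : ∀ {c ℓ₁ ℓ₂ e : Level} {R : TotalOrder c ℓ₁ ℓ₂} (T : UltraTriple R e)
    → (k : ℕ) (C : Fin k → UltraTriple.E T) → Injective _≡_ _≡_ C
    → (A : List (UltraTriple.E T)) → Unique A → k ≤ length A
    → (v : Fin k → UltraTriple.E T) → IsProjChoice T C A v
    → ∀ (j : Fin k) (a : UltraTriple.E T)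
    → a ∈ A → (∀ (i : Fin k) → toℕ i ≤ toℕ j → a ≢ v i)
    → ∀ (i : Fin k) → toℕ i ≤ toℕ j → a ≢ C i
proposition2p8 T _ _ _ A _ _ v choice j a a∈A a∉v i i≤j refl =
  a∉v i i≤j (sym (projChoice-fixes-remaining T choice i remainingAt-i))
  where
  remainingAfter-j : InRemaining T A v (suc (toℕ j)) a
  remainingAfter-j = a∈A , λ i′ i′<1+j → a∉v i′ (s≤s⁻¹ i′<1+j)

  remainingAt-i : InRemaining T A v (toℕ i) a
  remainingAt-i = InRemaining-antitone T (m≤n⇒m≤1+n i≤j) remainingAfter-j
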